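{- Let $r\ge 2$ and $k\ge 3$ be integers, let $R=R(k;r)$, let $\alpha=\binom{R}{k}^{ -1}$, and let $n\ge R$. For every coloring of the edges of $K_n$ with $r+1$ colors, either there are more than $\tfrac{\alpha}{2}\binom nk$ copies of $K_k$ all of whose edges receive the same color $i$ for some $i\in\{1,\dots,r\}$, or more than $\tfrac{1}{R^2}\binom n2$ edges receive color $r+1$.
   Context: $R(k;r)$ is the $r$-color Ramsey number of $K_k$: the smallest $N$ such that every coloring of the edges of $K_N$ with $r$ colors contains a monochromatic copy of $K_k$. -}

module Defs where

open import Data.Nat using (ℕ; zero; suc; _≤_)
open import Data.Nat.Properties using (_≟_)
open import Data.Fin using (Fin; _<_; _<?_; fromℕ; inject₁)
open import Data.Fin.Properties using (all?) renaming (_≟_ to _≟ᶠ_)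
open import Data.Fin.Subset using (Subset; inside; outside; _∈_; ∣_∣)
open import Data.Fin.Subset.Properties using (_∈?_)
open import Data.List using (List; []; _∷_; _++_; map; filter; length; allFin; cartesianProduct)
open import Data.Vec using (_∷_; [])
open import Data.Product using (Σ; ∃; _×_; _,_; proj₁; proj₂)
open import Relation.Nullary using (Dec; ¬_)
open import Relation.Nullary.Decidable using (_×-dec_; _→-dec_)
open import Relation.Binary.PropositionalEquality using (_≡_)

-- Convention: the colour of the edge {i , j} with i < j is  c i j ;
-- the values c i j with i ≥ j are ignored.  So colourings of this type
-- correspond exactly (surjectively) to colourings of the unordered pairs.
Colouring : ℕ → ℕ → Set
Colouring n r = Fin n → Fin n → Fin r

MonoClique : ∀ {n r} → Colouring n r → ℕ → Fin r → Subset n → Set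
MonoClique c k col S =
  ∣ S ∣ ≡ k × (∀ i j → i ∈ S → j ∈ S → i < j → c i j ≡ col)

RamseyProperty : ℕ → ℕ → ℕ → Set
RamseyProperty k r N =
  (c : Colouring N r) → Σ (Fin r) λ col → Σ (Subset N) λ S → MonoClique c k col S

IsRamseyNumber : ℕ → ℕ → ℕ → Set
IsRamseyNumber k r R = RamseyProperty k r R × (∀ N → RamseyProperty k r N → R ≤ N)

allSubsets : (n : ℕ) → List (Subset n)
allSubsets zero = [] ∷ []
allSubsets (suc n) = map (outside ∷_) (allSubsets n) ++ map (inside ∷_) (allSubsets n)

monoClique? : ∀ {n r} (c : Colouring n r) (k : ℕ) (col : Fin r) (S : Subset n) →
              Dec (MonoClique c k col S)
monoClique? c k col S =
  (∣ S ∣ ≟ k) ×-dec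
  all? (λ i → all? (λ j →
    (i ∈? S) →-dec ((j ∈? S) →-dec ((i <? j) →-dec (c i j ≟ᶠ col)))))

-- The (r+1)-colouring uses colours Fin (suc r); colours 1..r are the
-- elements inject₁ i (i : Fin r), colour r+1 is fromℕ r.

MonoCliqueLow : ∀ {n r} → Colouring n (suc r) → ℕ → Subset n → Set
MonoCliqueLow {r = r} c k S = ∃ λ (i : Fin r) → MonoClique c k (inject₁ i) S

monoCliqueLow? : ∀ {n r} (c : Colouring n (suc r)) (k : ℕ) (S : Subset n) →
                 Dec (MonoCliqueLow c k S)
monoCliqueLow? c k S = Data.Fin.Properties.any? (λ i → monoClique? c k (inject₁ i) S)
  where import Data.Fin.Properties

countMonoLow : ∀ {n r} → Colouring n (suc r) → ℕ → ℕ
countMonoLow {n} c k = length (filter (monoCliqueLow? c k) (allSubsets n))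

countTopEdges : ∀ {n r} → Colouring n (suc r) → ℕ
countTopEdges {n} {r} c =
  length (filter (λ p → (proj₁ p <? proj₂ p) ×-dec (c (proj₁ p) (proj₂ p) ≟ᶠ fromℕ r))
                 (cartesianProduct (allFin n) (allFin n)))

module Submission where

-- Double count over the R-element vertex sets T.  Each T contains an edge of colour r+1, or else the
-- colouring restricted to T uses only colours 1..r and, as |T| = R(k;r), T contains a K_k
-- monochromatic in one of them.  A k-set lies in C(n−k,R−k) of the sets T and an edge in C(n−2,R−2),
-- so with M, E the two counts of the statement C(n,R) ≤ M C(n−k,R−k) + E C(n−2,R−2).  By
-- C(n,R) C(R,s) = C(n,s) C(n−s,R−s), if both counts were small the right-hand side would be at most
-- C(n,R) (1/2 + C(R,2)/R²) < C(n,R).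

open import Defs
open import Data.Bool using (Bool; true; false; if_then_else_)
open import Data.Bool.Properties using (∧-identityʳ; ∧-zeroʳ)
open import Data.Fin using (Fin; zero; suc; toℕ; fromℕ; inject₁; lower₁) renaming (_<_ to _<ᶠ_; _<?_ to _<ᶠ?_)
open import Data.Fin.Properties using (inject₁-lower₁; toℕ-fromℕ; toℕ-injective) renaming (_≟_ to _≟ᶠ_; <⇒≢ to <ᶠ⇒≢)
open import Data.Fin.Subset using (Subset; inside; outside; ∣_∣; _∈_; _⊆_; ⊥; ∁; ⁅_⁆; _∪_)
open import Data.Fin.Subset.Properties
  using (_⊆?_; ⊥⊆; out⊆; s⊆s; ∣⊥∣≡0; ∣p∣≤n; ∣∁p∣≡n∸∣p∣; p⊆q⇒∣p∣≤∣q∣; ∣⁅x⁆∣≡1; x∈p∪q⁻; x∈⁅y⁆⇒x≡y; ∪-identityˡ; ∪-identityʳ)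
open import Data.List using (List; []; _∷_; _++_; map; filter; length; allFin; cartesianProduct)
open import Data.List.Membership.Propositional using () renaming (_∈_ to _∈ₗ_)
open import Data.List.Membership.Propositional.Properties
  using (∈-++⁺ˡ; ∈-++⁺ʳ; ∈-map⁺; ∈-filter⁺; ∈-filter⁻; ∈-cartesianProduct⁺; ∈-allFin)
open import Data.List.Relation.Unary.Any using (here; there)
open import Data.Nat using (ℕ; zero; suc; _+_; _*_; _∸_; _^_; _≤_; _<_; z≤n; s≤s; >-nonZero)
open import Data.Nat.Properties
  using (_≟_; _<?_; +-assoc; +-comm; +-identityʳ; *-identityʳ; +-suc; +-mono-≤; *-monoʳ-≤; *-mono-<; +-cancelˡ-≤; *-cancelʳ-≤;
         ≤-trans; ≤-reflexive; n≤1+n; m≤m+n; m≤n+m; m<m+n; 1+n≰n; <⇒≱; ≮⇒≥; m+[n∸m]≡n; module ≤-Reasoning)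
open import Data.Nat.Combinatorics using (_C_; nC1≡n; nCk+nC[k+1]≡[n+1]C[k+1])
open import Data.Nat.Tactic.RingSolver using (solve-∀)
open import Data.Product using (∃; _×_; _,_; proj₁; proj₂)
open import Data.Sum using (_⊎_; inj₁; inj₂)
open import Data.Vec using ([]; _∷_; here; there)
open import Relation.Nullary using (Dec; does; yes; no; ¬_; contradiction)
open import Relation.Nullary.Decidable using (_×-dec_)
open import Relation.Unary using (Pred; Decidable)
open import Relation.Binary.PropositionalEquality
open import Level using (Level)

private
  variable
    a : Level
    A : Set a
    n : ℕ

bit : Bool → ℕ
bit b = if b then 1 else 0

𝟙 : {P : Set a} → Dec P → ℕ
𝟙 P? = bit (does P?)

𝟙-yes : {P : Set a} (P? : Dec P) → P → 𝟙 P? ≡ 1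
𝟙-yes (yes _) _ = refl
𝟙-yes (no ¬p) p = contradiction p ¬p

𝟙-no : {P : Set a} (P? : Dec P) → ¬ P → 𝟙 P? ≡ 0
𝟙-no (yes p) ¬p = contradiction p ¬p
𝟙-no (no _) _ = refl

∑ : List A → (A → ℕ) → ℕ
∑ [] f = 0
∑ (x ∷ xs) f = f x + ∑ xs f

syntax ∑ xs (λ x → e) = ∑[ x ∈ xs ] e

∑-++ : (xs ys : List A) (f : A → ℕ) → ∑ (xs ++ ys) f ≡ ∑ xs f + ∑ ys f
∑-++ [] ys f = refl
∑-++ (x ∷ xs) ys f = trans (cong (f x +_) (∑-++ xs ys f)) (sym (+-assoc (f x) _ _))

∑-map : ∀ {b} {B : Set b} (g : A → B) (xs : List A) (f : B → ℕ) → ∑ (map g xs) f ≡ ∑[ x ∈ xs ] f (g x)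
∑-map g [] f = refl
∑-map g (x ∷ xs) f = cong (f (g x) +_) (∑-map g xs f)

∑-cong : (xs : List A) {f g : A → ℕ} → (∀ {x} → x ∈ₗ xs → f x ≡ g x) → ∑ xs f ≡ ∑ xs g
∑-cong [] eq = refl
∑-cong (x ∷ xs) eq = cong₂ _+_ (eq (here refl)) (∑-cong xs (λ x∈ → eq (there x∈)))

∑-zero : (xs : List A) {f : A → ℕ} → (∀ x → f x ≡ 0) → ∑ xs f ≡ 0
∑-zero [] _ = refl
∑-zero (x ∷ xs) f≡0 = cong₂ _+_ (f≡0 x) (∑-zero xs f≡0)

∑-const : (xs : List A) (c : ℕ) → ∑[ _ ∈ xs ] c ≡ length xs * c
∑-const [] c = refl
∑-const (x ∷ xs) c = cong (c +_) (∑-const xs c)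

∑-1 : (xs : List A) → ∑[ _ ∈ xs ] 1 ≡ length xs
∑-1 [] = refl
∑-1 (x ∷ xs) = cong suc (∑-1 xs)

∑-mono-≤ : (xs : List A) {f g : A → ℕ} → (∀ {x} → x ∈ₗ xs → f x ≤ g x) → ∑ xs f ≤ ∑ xs g
∑-mono-≤ [] le = z≤n
∑-mono-≤ (x ∷ xs) le = +-mono-≤ (le (here refl)) (∑-mono-≤ xs (λ x∈ → le (there x∈)))

∈⇒≤∑ : {xs : List A} (f : A → ℕ) {x : A} → x ∈ₗ xs → f x ≤ ∑ xs f
∈⇒≤∑ {xs = _ ∷ xs} f (here refl) = m≤m+n _ (∑ xs f)
∈⇒≤∑ {xs = y ∷ _} f (there x∈) = ≤-trans (∈⇒≤∑ f x∈) (m≤n+m _ (f y))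

∑-distrib-+ : (xs : List A) (f g : A → ℕ) → ∑[ x ∈ xs ] (f x + g x) ≡ ∑ xs f + ∑ xs g
∑-distrib-+ [] f g = refl
∑-distrib-+ (x ∷ xs) f g = trans (cong (f x + g x +_) (∑-distrib-+ xs f g)) (interchange (f x) (g x) _ _)
  where
  interchange : ∀ p q r s → p + q + (r + s) ≡ p + r + (q + s)
  interchange = solve-∀

∑-comm : ∀ {b} {B : Set b} (xs : List A) (ys : List B) (f : A → B → ℕ) →
         ∑[ x ∈ xs ] ∑[ y ∈ ys ] f x y ≡ ∑[ y ∈ ys ] ∑[ x ∈ xs ] f x y
∑-comm [] ys f = sym (∑-zero ys (λ _ → refl))
∑-comm (x ∷ xs) ys f = trans (cong (∑ ys (f x) +_) (∑-comm xs ys f))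
                             (sym (∑-distrib-+ ys (f x) (λ y → ∑[ x ∈ xs ] f x y)))

∑-filter-𝟙 : ∀ {p q} {P : Pred A p} {Q : Pred A q} (P? : Decidable P) (Q? : Decidable Q) (xs : List A) →
             ∑[ x ∈ filter Q? xs ] 𝟙 (P? x) ≡ ∑[ x ∈ xs ] 𝟙 (P? x ×-dec Q? x)
∑-filter-𝟙 P? Q? [] = refl
∑-filter-𝟙 P? Q? (x ∷ xs) with does (Q? x)
... | true  = cong₂ _+_ (cong bit (sym (∧-identityʳ (does (P? x))))) (∑-filter-𝟙 P? Q? xs)
... | false = trans (∑-filter-𝟙 P? Q? xs) (cong (λ b → bit b + _) (sym (∧-zeroʳ (does (P? x)))))

nC[k+1]+nCk≡[n+1]C[k+1] : ∀ n k → n C suc k + n C k ≡ suc n C suc k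
nC[k+1]+nCk≡[n+1]C[k+1] n k = trans (+-comm (n C suc k) (n C k)) (nCk+nC[k+1]≡[n+1]C[k+1] n k)

0<nCk : ∀ {n k} → k ≤ n → 0 < n C k
0<nCk {k = zero} _ = s≤s z≤n
0<nCk {suc n} {suc k} (s≤s k≤n) =
  subst (0 <_) (nCk+nC[k+1]≡[n+1]C[k+1] n k) (≤-trans (0<nCk k≤n) (m≤m+n _ _))

2*nC2+n≡n*n : ∀ n → 2 * (n C 2) + n ≡ n * n
2*nC2+n≡n*n zero = refl
2*nC2+n≡n*n (suc n) = begin
  2 * (suc n C 2) + suc n         ≡⟨ cong (λ m → 2 * m + suc n) (nCk+nC[k+1]≡[n+1]C[k+1] n 1) ⟨
  2 * (n C 1 + n C 2) + suc n     ≡⟨ cong (λ m → 2 * (m + n C 2) + suc n) (nC1≡n n) ⟩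
  2 * (n + n C 2) + suc n         ≡⟨ regroup n (n C 2) ⟩
  (2 * (n C 2) + n) + (2 * n + 1) ≡⟨ cong (_+ (2 * n + 1)) (2*nC2+n≡n*n n) ⟩
  n * n + (2 * n + 1)             ≡⟨ square-suc n ⟩
  suc n * suc n                   ∎
  where
  open ≡-Reasoning
  regroup : ∀ m c → 2 * (m + c) + suc m ≡ (2 * c + m) + (2 * m + 1)
  regroup = solve-∀
  square-suc : ∀ m → m * m + (2 * m + 1) ≡ suc m * suc m
  square-suc = solve-∀

2*nC2<n^2 : ∀ {n} → 0 < n → 2 * (n C 2) < n ^ 2
2*nC2<n^2 {n} 0<n = subst (2 * (n C 2) <_) (trans (2*nC2+n≡n*n n) (cong (n *_) (sym (*-identityʳ n)))) (m<m+n _ 0<n)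

∈-allSubsets : (S : Subset n) → S ∈ₗ allSubsets n
∈-allSubsets [] = here refl
∈-allSubsets {suc n} (outside ∷ S) = ∈-++⁺ˡ (∈-map⁺ (outside ∷_) (∈-allSubsets S))
∈-allSubsets {suc n} (inside ∷ S) =
  ∈-++⁺ʳ (map (outside ∷_) (allSubsets n)) (∈-map⁺ (inside ∷_) (∈-allSubsets S))

∑-allSubsets-suc : ∀ n (f : Subset (suc n) → ℕ) →
  ∑ (allSubsets (suc n)) f ≡ ∑[ S ∈ allSubsets n ] f (outside ∷ S) + ∑[ S ∈ allSubsets n ] f (inside ∷ S)
∑-allSubsets-suc n f = trans (∑-++ (map (outside ∷_) (allSubsets n)) _ f)
  (cong₂ _+_ (∑-map (outside ∷_) (allSubsets n) f) (∑-map (inside ∷_) (allSubsets n) f))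

count-subsets : (T : Subset n) (k : ℕ) → ∑[ S ∈ allSubsets n ] 𝟙 (S ⊆? T ×-dec ∣ S ∣ ≟ k) ≡ ∣ T ∣ C k
count-subsets [] zero = refl
count-subsets [] (suc k) = refl
count-subsets {suc n} (outside ∷ T) k = trans (∑-allSubsets-suc n _)
  (trans (cong₂ _+_ (count-subsets T k) (∑-zero (allSubsets n) (λ _ → refl))) (+-identityʳ _))
count-subsets {suc n} (inside ∷ T) zero = trans (∑-allSubsets-suc n _)
  (cong₂ _+_ (count-subsets T zero) (∑-zero (allSubsets n) (λ S → cong bit (∧-zeroʳ (does (S ⊆? T))))))
count-subsets {suc n} (inside ∷ T) (suc k) = trans (∑-allSubsets-suc n _)
  (trans (cong₂ _+_ (count-subsets T (suc k)) (count-subsets T k)) (nC[k+1]+nCk≡[n+1]C[k+1] ∣ T ∣ k))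

count-supersets : (S : Subset n) (j : ℕ) →
  ∑[ T ∈ allSubsets n ] 𝟙 (S ⊆? T ×-dec ∣ T ∣ ≟ ∣ S ∣ + j) ≡ ∣ ∁ S ∣ C j
count-supersets [] zero = refl
count-supersets [] (suc j) = refl
count-supersets {suc n} (outside ∷ S) zero = trans (∑-allSubsets-suc n _)
  (cong₂ _+_ (count-supersets S zero) (∑-zero (allSubsets n) too-big))
  where
  too-big : ∀ T → 𝟙 (S ⊆? T ×-dec suc ∣ T ∣ ≟ ∣ S ∣ + 0) ≡ 0
  too-big T = 𝟙-no (S ⊆? T ×-dec suc ∣ T ∣ ≟ ∣ S ∣ + 0) λ (S⊆T , eq) →
    1+n≰n (≤-trans (≤-reflexive (trans eq (+-identityʳ _))) (p⊆q⇒∣p∣≤∣q∣ S⊆T))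
count-supersets {suc n} (outside ∷ S) (suc j) = trans (∑-allSubsets-suc n _)
  (trans (cong₂ _+_ (count-supersets S (suc j)) (trans (∑-cong (allSubsets n) grow) (count-supersets S j)))
         (nC[k+1]+nCk≡[n+1]C[k+1] ∣ ∁ S ∣ j))
  where
  grow : ∀ {T} → T ∈ₗ allSubsets n →
         𝟙 (S ⊆? T ×-dec suc ∣ T ∣ ≟ ∣ S ∣ + suc j) ≡ 𝟙 (S ⊆? T ×-dec suc ∣ T ∣ ≟ suc (∣ S ∣ + j))
  grow {T} _ = cong (λ m → 𝟙 (S ⊆? T ×-dec suc ∣ T ∣ ≟ m)) (+-suc ∣ S ∣ j)
count-supersets {suc n} (inside ∷ S) j = trans (∑-allSubsets-suc n _)
  (cong₂ _+_ (∑-zero (allSubsets n) (λ _ → refl)) (count-supersets S j))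

subsetsOfSize : ∀ n → ℕ → List (Subset n)
subsetsOfSize n k = filter (λ S → ∣ S ∣ ≟ k) (allSubsets n)

∈-subsetsOfSize⁻ : ∀ {k} {S : Subset n} → S ∈ₗ subsetsOfSize n k → ∣ S ∣ ≡ k
∈-subsetsOfSize⁻ {n} {k} S∈ = proj₂ (∈-filter⁻ (λ S → ∣ S ∣ ≟ k) {xs = allSubsets n} S∈)

∑-subsetsOfSize-⊆ : (T : Subset n) (k : ℕ) → ∑[ S ∈ subsetsOfSize n k ] 𝟙 (S ⊆? T) ≡ ∣ T ∣ C k
∑-subsetsOfSize-⊆ {n} T k = trans (∑-filter-𝟙 (_⊆? T) (λ S → ∣ S ∣ ≟ k) (allSubsets n)) (count-subsets T k)

∑-subsetsOfSize-⊇ : ∀ {s R} (S : Subset n) → ∣ S ∣ ≡ s → s ≤ R →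
  ∑[ T ∈ subsetsOfSize n R ] 𝟙 (S ⊆? T) ≡ (n ∸ s) C (R ∸ s)
∑-subsetsOfSize-⊇ {n} {R = R} S refl s≤R = begin
  ∑[ T ∈ subsetsOfSize n R ] 𝟙 (S ⊆? T)              ≡⟨ ∑-filter-𝟙 (S ⊆?_) (λ T → ∣ T ∣ ≟ R) (allSubsets n) ⟩
  ∑[ T ∈ allSubsets n ] 𝟙 (S ⊆? T ×-dec ∣ T ∣ ≟ R)  ≡⟨ cong (λ m → ∑[ T ∈ allSubsets n ] 𝟙 (S ⊆? T ×-dec ∣ T ∣ ≟ m))
                                                           (sym (m+[n∸m]≡n s≤R)) ⟩
  ∑[ T ∈ allSubsets n ] 𝟙 (S ⊆? T ×-dec ∣ T ∣ ≟ ∣ S ∣ + (R ∸ ∣ S ∣))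
                                                     ≡⟨ count-supersets S (R ∸ ∣ S ∣) ⟩
  ∣ ∁ S ∣ C (R ∸ ∣ S ∣)                             ≡⟨ cong (_C (R ∸ ∣ S ∣)) (∣∁p∣≡n∸∣p∣ S) ⟩
  (n ∸ ∣ S ∣) C (R ∸ ∣ S ∣)                         ∎
  where open ≡-Reasoning

length-subsetsOfSize : ∀ n R → length (subsetsOfSize n R) ≡ n C R
length-subsetsOfSize n R = begin
  length (subsetsOfSize n R)             ≡⟨ ∑-1 (subsetsOfSize n R) ⟨
  ∑[ T ∈ subsetsOfSize n R ] 1           ≡⟨ ∑-cong (subsetsOfSize n R) (λ {T} _ → 𝟙-yes (⊥ ⊆? T) ⊥⊆) ⟨
  ∑[ T ∈ subsetsOfSize n R ] 𝟙 (⊥ ⊆? T) ≡⟨ ∑-subsetsOfSize-⊇ {R = R} ⊥ (∣⊥∣≡0 n) z≤n ⟩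
  n C R                                  ∎
  where open ≡-Reasoning

∑-subsetsOfSize-∑⊆ : ∀ {s R} (xs : List A) (g : A → Subset n) → (∀ {x} → x ∈ₗ xs → ∣ g x ∣ ≡ s) → s ≤ R →
  ∑[ T ∈ subsetsOfSize n R ] ∑[ x ∈ xs ] 𝟙 (g x ⊆? T) ≡ length xs * ((n ∸ s) C (R ∸ s))
∑-subsetsOfSize-∑⊆ {n = n} {s} {R} xs g ∣g∣≡s s≤R = begin
  ∑[ T ∈ subsetsOfSize n R ] ∑[ x ∈ xs ] 𝟙 (g x ⊆? T) ≡⟨ ∑-comm (subsetsOfSize n R) xs _ ⟩
  ∑[ x ∈ xs ] ∑[ T ∈ subsetsOfSize n R ] 𝟙 (g x ⊆? T) ≡⟨ ∑-cong xs (λ {x} x∈ → ∑-subsetsOfSize-⊇ (g x) (∣g∣≡s x∈) s≤R) ⟩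
  ∑[ x ∈ xs ] ((n ∸ s) C (R ∸ s))                    ≡⟨ ∑-const xs _ ⟩
  length xs * ((n ∸ s) C (R ∸ s))                    ∎
  where open ≡-Reasoning

nCR*RCs≡nCs*[n∸s]C[R∸s] : ∀ n {R s} → s ≤ R → (n C R) * (R C s) ≡ (n C s) * ((n ∸ s) C (R ∸ s))
nCR*RCs≡nCs*[n∸s]C[R∸s] n {R} {s} s≤R = begin
  (n C R) * (R C s)                                 ≡⟨ cong (_* (R C s)) (length-subsetsOfSize n R) ⟨
  length (subsetsOfSize n R) * (R C s)              ≡⟨ ∑-const (subsetsOfSize n R) _ ⟨
  ∑[ T ∈ subsetsOfSize n R ] (R C s)                ≡⟨ ∑-cong (subsetsOfSize n R) (λ {T} T∈ →
                                                         trans (∑-subsetsOfSize-⊆ T s) (cong (_C s) (∈-subsetsOfSize⁻ T∈))) ⟨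
  ∑[ T ∈ subsetsOfSize n R ] ∑[ S ∈ subsetsOfSize n s ] 𝟙 (S ⊆? T)
                                                    ≡⟨ ∑-subsetsOfSize-∑⊆ (subsetsOfSize n s) (λ S → S) ∈-subsetsOfSize⁻ s≤R ⟩
  length (subsetsOfSize n s) * ((n ∸ s) C (R ∸ s))  ≡⟨ cong (_* ((n ∸ s) C (R ∸ s))) (length-subsetsOfSize n s) ⟩
  (n C s) * ((n ∸ s) C (R ∸ s))                     ∎
  where open ≡-Reasoning

enumerate : (T : Subset n) → Fin ∣ T ∣ → Fin n
enumerate (outside ∷ T) a = suc (enumerate T a)
enumerate (inside ∷ T) zero = zero
enumerate (inside ∷ T) (suc a) = suc (enumerate T a)

enumerate-∈ : (T : Subset n) (a : Fin ∣ T ∣) → enumerate T a ∈ T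
enumerate-∈ (outside ∷ T) a = there (enumerate-∈ T a)
enumerate-∈ (inside ∷ T) zero = here
enumerate-∈ (inside ∷ T) (suc a) = there (enumerate-∈ T a)

enumerate-cancel-< : (T : Subset n) (a b : Fin ∣ T ∣) → enumerate T a <ᶠ enumerate T b → a <ᶠ b
enumerate-cancel-< (outside ∷ T) a b (s≤s lt) = enumerate-cancel-< T a b lt
enumerate-cancel-< (inside ∷ T) zero (suc b) lt = s≤s z≤n
enumerate-cancel-< (inside ∷ T) (suc a) (suc b) (s≤s lt) = s≤s (enumerate-cancel-< T a b lt)

embed : (T : Subset n) → Subset ∣ T ∣ → Subset n
embed [] [] = []
embed (outside ∷ T) S = outside ∷ embed T S
embed (inside ∷ T) (b ∷ S) = b ∷ embed T S

∣embed∣ : (T : Subset n) (S : Subset ∣ T ∣) → ∣ embed T S ∣ ≡ ∣ S ∣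
∣embed∣ [] [] = refl
∣embed∣ (outside ∷ T) S = ∣embed∣ T S
∣embed∣ (inside ∷ T) (outside ∷ S) = ∣embed∣ T S
∣embed∣ (inside ∷ T) (inside ∷ S) = cong suc (∣embed∣ T S)

embed-⊆ : (T : Subset n) (S : Subset ∣ T ∣) → embed T S ⊆ T
embed-⊆ [] [] ()
embed-⊆ (outside ∷ T) S = out⊆ (embed-⊆ T S)
embed-⊆ (inside ∷ T) (outside ∷ S) = out⊆ (embed-⊆ T S)
embed-⊆ (inside ∷ T) (inside ∷ S) = s⊆s (embed-⊆ T S)

∈-embed⁻ : (T : Subset n) (S : Subset ∣ T ∣) {x : Fin n} → x ∈ embed T S → ∃ λ a → a ∈ S × enumerate T a ≡ x
∈-embed⁻ (outside ∷ T) S (there x∈) with ∈-embed⁻ T S x∈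
... | a , a∈ , refl = a , a∈ , refl
∈-embed⁻ (inside ∷ T) (inside ∷ S) here = zero , here , refl
∈-embed⁻ (inside ∷ T) (_ ∷ S) (there x∈) with ∈-embed⁻ T S x∈
... | a , a∈ , refl = suc a , there a∈ , refl

dropTop : ∀ {r} → Fin r → Fin (suc r) → Fin r
dropTop {r} d x with r ≟ toℕ x
... | yes _ = d
... | no r≢x = lower₁ x r≢x

inject₁-dropTop : ∀ {r} (d : Fin r) {x : Fin (suc r)} → x ≢ fromℕ r → inject₁ (dropTop d x) ≡ x
inject₁-dropTop {r} d {x} x≢top with r ≟ toℕ x
... | yes r≡x = contradiction (toℕ-injective (trans (sym r≡x) (sym (toℕ-fromℕ r)))) x≢top
... | no r≢x = inject₁-lower₁ x r≢x

RamseyProperty⇒k≤N : ∀ {k r N} → RamseyProperty k (suc r) N → k ≤ N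
RamseyProperty⇒k≤N {N = N} ramsey with ramsey (λ _ _ → zero)
... | _ , S , ∣S∣≡k , _ = subst (_≤ N) ∣S∣≡k (∣p∣≤n S)

monoCliqueLow-⊆ : ∀ {r k} (T : Subset n) → RamseyProperty k (suc r) ∣ T ∣ → (c : Colouring n (suc (suc r))) →
  (∀ {i j} → i ∈ T → j ∈ T → i <ᶠ j → c i j ≢ fromℕ (suc r)) →
  ∃ λ S → S ⊆ T × MonoCliqueLow c k S
-- The top colour does not occur inside T, so replacing it by colour 1 changes nothing there.
monoCliqueLow-⊆ T ramsey c no-top with ramsey (λ a b → dropTop zero (c (enumerate T a) (enumerate T b)))
... | col , S , ∣S∣≡k , mono = embed T S , embed-⊆ T S , col , trans (∣embed∣ T S) ∣S∣≡k , mono′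
  where
  mono′ : ∀ x y → x ∈ embed T S → y ∈ embed T S → x <ᶠ y → c x y ≡ inject₁ col
  mono′ x y x∈ y∈ x<y with ∈-embed⁻ T S x∈ | ∈-embed⁻ T S y∈
  ... | a , a∈ , refl | b , b∈ , refl = begin
    c x y                          ≡⟨ inject₁-dropTop zero (no-top (enumerate-∈ T a) (enumerate-∈ T b) x<y) ⟨
    inject₁ (dropTop zero (c x y)) ≡⟨ cong inject₁ (mono a b a∈ b∈ (enumerate-cancel-< T a b x<y)) ⟩
    inject₁ col                    ∎
    where open ≡-Reasoning

edge : Fin n × Fin n → Subset n
edge (i , j) = ⁅ i ⁆ ∪ ⁅ j ⁆

∣edge∣ : {i j : Fin n} → i ≢ j → ∣ edge (i , j) ∣ ≡ 2
∣edge∣ {i = zero} {zero} i≢j = contradiction refl i≢j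
∣edge∣ {suc n} {zero} {suc j} _ = cong suc (trans (cong ∣_∣ (∪-identityˡ ⁅ j ⁆)) (∣⁅x⁆∣≡1 j))
∣edge∣ {suc n} {suc i} {zero} _ = cong suc (trans (cong ∣_∣ (∪-identityʳ ⁅ i ⁆)) (∣⁅x⁆∣≡1 i))
∣edge∣ {i = suc i} {suc j} i≢j = ∣edge∣ (λ i≡j → i≢j (cong suc i≡j))

edge-⊆ : {i j : Fin n} {T : Subset n} → i ∈ T → j ∈ T → edge (i , j) ⊆ T
edge-⊆ {i = i} {j} i∈T j∈T x∈ with x∈p∪q⁻ ⁅ i ⁆ ⁅ j ⁆ x∈
... | inj₁ x∈⁅i⁆ rewrite x∈⁅y⁆⇒x≡y i x∈⁅i⁆ = i∈T
... | inj₂ x∈⁅j⁆ rewrite x∈⁅y⁆⇒x≡y j x∈⁅j⁆ = j∈T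

module _ {r : ℕ} (c : Colouring n (suc r)) where

  monoSets : ℕ → List (Subset n)
  monoSets k = filter (monoCliqueLow? c k) (allSubsets n)

  isTopEdge? : (e : Fin n × Fin n) → Dec (proj₁ e <ᶠ proj₂ e × c (proj₁ e) (proj₂ e) ≡ fromℕ r)
  isTopEdge? e = (proj₁ e <ᶠ? proj₂ e) ×-dec (c (proj₁ e) (proj₂ e) ≟ᶠ fromℕ r)

  topEdges : List (Fin n × Fin n)
  topEdges = filter isTopEdge? (cartesianProduct (allFin n) (allFin n))

  ∣∣-monoSets : ∀ {k S} → S ∈ₗ monoSets k → ∣ S ∣ ≡ k
  ∣∣-monoSets {k} S∈ = proj₁ (proj₂ (proj₂ (∈-filter⁻ (monoCliqueLow? c k) {xs = allSubsets n} S∈)))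

  ∣edge∣-topEdges : ∀ {e} → e ∈ₗ topEdges → ∣ edge e ∣ ≡ 2
  ∣edge∣-topEdges e∈ =
    ∣edge∣ (<ᶠ⇒≢ (proj₁ (proj₂ (∈-filter⁻ isTopEdge? {xs = cartesianProduct (allFin n) (allFin n)} e∈))))

  monoInside : ℕ → Subset n → ℕ
  monoInside k T = ∑[ S ∈ monoSets k ] 𝟙 (S ⊆? T)

  topInside : Subset n → ℕ
  topInside T = ∑[ e ∈ topEdges ] 𝟙 (edge e ⊆? T)

  topInside≡0⇒no-top : ∀ {T} → topInside T ≡ 0 → ∀ {i j} → i ∈ T → j ∈ T → i <ᶠ j → c i j ≢ fromℕ r
  topInside≡0⇒no-top {T} none {i} {j} i∈T j∈T i<j top = 1+n≰n (begin
    1                        ≡⟨ 𝟙-yes (edge (i , j) ⊆? T) (edge-⊆ i∈T j∈T) ⟨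
    𝟙 (edge (i , j) ⊆? T)    ≤⟨ ∈⇒≤∑ (λ e → 𝟙 (edge e ⊆? T))
                                  (∈-filter⁺ isTopEdge? (∈-cartesianProduct⁺ (∈-allFin i) (∈-allFin j)) (i<j , top)) ⟩
    topInside T              ≡⟨ none ⟩
    0                        ∎)
    where open ≤-Reasoning

mono-or-top-inside : ∀ {r k R} (c : Colouring n (suc (suc r))) → RamseyProperty k (suc r) R →
  ∀ {T} → T ∈ₗ subsetsOfSize n R → 1 ≤ monoInside c k T + topInside c T
mono-or-top-inside {r = r} {k} c ramsey {T} T∈ with topInside c T in none
... | suc m = ≤-trans (s≤s z≤n) (m≤n+m (suc m) (monoInside c k T))
... | zero with monoCliqueLow-⊆ T (subst (RamseyProperty k (suc r)) (sym (∈-subsetsOfSize⁻ T∈)) ramsey) c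
                                  (topInside≡0⇒no-top c none)
...   | S , S⊆T , mono = begin
  1                       ≡⟨ 𝟙-yes (S ⊆? T) S⊆T ⟨
  𝟙 (S ⊆? T)              ≤⟨ ∈⇒≤∑ (λ S → 𝟙 (S ⊆? T)) (∈-filter⁺ (monoCliqueLow? c k) (∈-allSubsets S) mono) ⟩
  monoInside c k T        ≤⟨ m≤m+n _ 0 ⟩
  monoInside c k T + 0    ∎
  where open ≤-Reasoning

nCR≤M*[n∸k]C[R∸k]+E*[n∸2]C[R∸2] : ∀ {r k R} (c : Colouring n (suc (suc r))) →
  RamseyProperty k (suc r) R → k ≤ R → 2 ≤ R →
  n C R ≤ countMonoLow c k * ((n ∸ k) C (R ∸ k)) + countTopEdges c * ((n ∸ 2) C (R ∸ 2))
nCR≤M*[n∸k]C[R∸k]+E*[n∸2]C[R∸2] {n} {k = k} {R} c ramsey k≤R 2≤R = begin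
  n C R                                    ≡⟨ length-subsetsOfSize n R ⟨
  length (subsetsOfSize n R)               ≡⟨ ∑-1 (subsetsOfSize n R) ⟨
  ∑[ T ∈ subsetsOfSize n R ] 1             ≤⟨ ∑-mono-≤ (subsetsOfSize n R) (mono-or-top-inside c ramsey) ⟩
  ∑[ T ∈ subsetsOfSize n R ] (monoInside c k T + topInside c T)
                                           ≡⟨ ∑-distrib-+ (subsetsOfSize n R) (monoInside c k) (topInside c) ⟩
  ∑ (subsetsOfSize n R) (monoInside c k) + ∑ (subsetsOfSize n R) (topInside c)
                                           ≡⟨ cong₂ _+_ (∑-subsetsOfSize-∑⊆ (monoSets c k) (λ S → S) (∣∣-monoSets c) k≤R)
                                                        (∑-subsetsOfSize-∑⊆ (topEdges c) edge (∣edge∣-topEdges c) 2≤R) ⟩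
  countMonoLow c k * ((n ∸ k) C (R ∸ k)) + countTopEdges c * ((n ∸ 2) C (R ∸ 2)) ∎
  where open ≤-Reasoning

-- Dividing the first hypothesis by A gives 1 ≤ x M / a + y E / b ≤ 1/2 + y / Q.
averaging : ∀ {A B D M E a b x y Q} →
  A ≤ M * B + E * D → A * x ≡ a * B → A * y ≡ b * D → 0 < A * x →
  2 * x * M ≤ a → Q * E ≤ b → Q ≤ 2 * y
averaging {A} {B} {D} {M} {E} {a} {b} {x} {y} {Q} A≤ Ax≡aB Ay≡bD 0<Ax 2xM≤a QE≤b =
  *-cancelʳ-≤ Q (2 * y) (A * x) (+-cancelˡ-≤ (Q * (A * x)) _ _ (begin
    Q * (A * x) + Q * (A * x)                 ≡⟨ twice A x Q ⟩
    2 * Q * x * A                             ≤⟨ *-monoʳ-≤ (2 * Q * x) A≤ ⟩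
    2 * Q * x * (M * B + E * D)               ≡⟨ expand B D M E x Q ⟩
    Q * B * (2 * x * M) + 2 * x * D * (Q * E) ≤⟨ +-mono-≤ (*-monoʳ-≤ (Q * B) 2xM≤a) (*-monoʳ-≤ (2 * x * D) QE≤b) ⟩
    Q * B * a + 2 * x * D * b                 ≡⟨ regroup B D a b x Q ⟩
    Q * (a * B) + 2 * x * (b * D)             ≡⟨ cong₂ (λ u v → Q * u + 2 * x * v) Ax≡aB Ay≡bD ⟨
    Q * (A * x) + 2 * x * (A * y)             ≡⟨ collect A x y Q ⟩
    Q * (A * x) + 2 * y * (A * x)             ∎))
  where
  open ≤-Reasoning
  instance _ = >-nonZero 0<Ax
  twice : ∀ A x Q → Q * (A * x) + Q * (A * x) ≡ 2 * Q * x * A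
  twice = solve-∀
  expand : ∀ B D M E x Q → 2 * Q * x * (M * B + E * D) ≡ Q * B * (2 * x * M) + 2 * x * D * (Q * E)
  expand = solve-∀
  regroup : ∀ B D a b x Q → Q * B * a + 2 * x * D * b ≡ Q * (a * B) + 2 * x * (b * D)
  regroup = solve-∀
  collect : ∀ A x y Q → Q * (A * x) + 2 * x * (A * y) ≡ Q * (A * x) + 2 * y * (A * x)
  collect = solve-∀

proposition2p6 : (r k R n : ℕ) → 2 ≤ r → 3 ≤ k → IsRamseyNumber k r R → R ≤ n →
                 (c : Colouring n (suc r)) →
                 (n C k < 2 * (R C k) * countMonoLow c k)
                 ⊎ (n C 2 < R ^ 2 * countTopEdges c)
proposition2p6 zero _ _ _ () _ _ _ _
proposition2p6 (suc r) k R n _ 3≤k (ramsey , _) R≤n c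
  with n C k <? 2 * (R C k) * countMonoLow c k | n C 2 <? R ^ 2 * countTopEdges c
... | yes many-mono | _            = inj₁ many-mono
... | no _          | yes many-top = inj₂ many-top
... | no few-mono   | no few-top   = contradiction R^2≤2*RC2 (<⇒≱ (2*nC2<n^2 (≤-trans (s≤s z≤n) 2≤R)))
  where
  k≤R : k ≤ R
  k≤R = RamseyProperty⇒k≤N ramsey
  2≤R : 2 ≤ R
  2≤R = ≤-trans (n≤1+n 2) (≤-trans 3≤k k≤R)
  R^2≤2*RC2 : R ^ 2 ≤ 2 * (R C 2)
  R^2≤2*RC2 = averaging (nCR≤M*[n∸k]C[R∸k]+E*[n∸2]C[R∸2] c ramsey k≤R 2≤R)
                        (nCR*RCs≡nCs*[n∸s]C[R∸s] n k≤R) (nCR*RCs≡nCs*[n∸s]C[R∸s] n 2≤R)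
                        (*-mono-< (0<nCk R≤n) (0<nCk k≤R)) (≮⇒≥ few-mono) (≮⇒≥ few-top)
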